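{- Let $S_0,S_1\subseteq\mathbb Z_{\ge 0}$ with $0\in S_0$ and $1\in S_1$. Assume there is a positive integer $n$ such that for all $a\in S_0$ and all (not necessarily distinct) $b_1,\dots,b_n\in S_1$ we have $b_1+\cdots+b_n\in S_0$ and $a+b_1+\cdots+b_{n-1}\in S_1$. If $n$ is odd, then there is a nonnegative integer $A(n)$, depending only on $n$, with $A(n)\in S_0\cap S_1$. If $n$ is even, then there is a nonnegative integer $d(n)$, depending only on $n$, such that $S_0$ contains all even integers at least $d(n)$ and $S_1$ contains all odd integers at least $d(n)$. -}

module Defs where

open import Data.Nat using (ℕ; suc; _+_; _*_; _∸_)
open import Data.Vec using (Vec; sum)
open import Data.Vec.Relation.Unary.All using (All)
open import Data.Product using (∃; _×_)
open import Relation.Binary.PropositionalEquality using (_≡_)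

Even : ℕ → Set
Even m = ∃ λ k → m ≡ 2 * k

Odd : ℕ → Set
Odd m = ∃ λ k → m ≡ suc (2 * k)

record Hyp (n : ℕ) (S₀ S₁ : ℕ → Set) : Set where
  field
    zero∈S₀ : S₀ 0
    one∈S₁  : S₁ 1
    sum∈S₀  : ∀ a → S₀ a → (b : Vec ℕ n) → All S₁ b → S₀ (sum b)
    shift∈S₁ : ∀ a → S₀ a → (b : Vec ℕ (n ∸ 1)) → All S₁ b → S₁ (a + sum b)

-- Write n = m + 1.  Ones play the role of free summands: feeding the vector (x, 1, …, 1) into
-- the two closure rules shows S₁ + m ⊆ S₀ and S₀ + m ⊆ S₁, so S₁ is closed under adding 2m,
-- and also under adding m − 1.  For m = 2k both steps are even, and 1 + m² lies in S₁ (k steps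
-- of size 2m) and in S₀ (as (1 + m(m − 1)) + m).  For m = 2q + 1 the halved steps q and 2q + 1
-- are coprime, so every number beyond 2q² is a combination of them; hence S₁ contains every
-- odd number beyond 4q², and adding m gives the large even numbers in S₀.
module Submission where

open import Defs
open import Data.Nat using (ℕ; zero; suc; _+_; _*_; _∸_; _≤_; s≤s; s≤s⁻¹)
open import Data.Nat.Properties
open import Data.Nat.DivMod using (_%_; _/_; m≡m%n+[m/n]*n; m%n<n)
open import Data.Nat.Tactic.RingSolver using (solve-∀)
open import Data.Product using (∃; ∃₂; _×_; _,_; map₂)
open import Data.Vec using (Vec; sum; replicate; _∷_)
open import Data.Vec.Relation.Unary.All using (All; _∷_; [])
open import Relation.Binary.PropositionalEquality using (_≡_; refl; sym; trans; cong; subst)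

ones : ∀ k → Vec ℕ k
ones k = replicate k 1

sum-ones : ∀ k → sum (ones k) ≡ k
sum-ones zero    = refl
sum-ones (suc k) = cong suc (sum-ones k)

ClosedUnder+ : (ℕ → Set) → ℕ → Set
ClosedUnder+ P a = ∀ x → P x → P (x + a)

closedUnder+-* : ∀ {P a} → ClosedUnder+ P a → ∀ i → ClosedUnder+ P (i * a)
closedUnder+-* {P} _ zero x px = subst P (sym (+-identityʳ x)) px
closedUnder+-* {P} {a} closed (suc i) x px =
  subst P (+-assoc x a (i * a)) (closedUnder+-* closed i (x + a) (closed x px))

module _ {m} {S₀ S₁ : ℕ → Set} (H : Hyp (suc m) S₀ S₁) where
  open Hyp H

  All-ones : ∀ k → All S₁ (ones k)
  All-ones zero    = []
  All-ones (suc k) = one∈S₁ ∷ All-ones k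

  S₁⇒S₀[+m] : ∀ {x} → S₁ x → S₀ (x + m)
  S₁⇒S₀[+m] {x} x∈S₁ = subst S₀ (cong (x +_) (sum-ones m))
    (sum∈S₀ 0 zero∈S₀ (x ∷ ones m) (x∈S₁ ∷ All-ones m))

  S₀⇒S₁[+m] : ∀ {a} → S₀ a → S₁ (a + m)
  S₀⇒S₁[+m] {a} a∈S₀ = subst S₁ (cong (a +_) (sum-ones m))
    (shift∈S₁ a a∈S₀ (ones m) (All-ones m))

  S₁-closed[+m+m] : ClosedUnder+ S₁ (m + m)
  S₁-closed[+m+m] x x∈S₁ = subst S₁ (+-assoc x m m) (S₀⇒S₁[+m] (S₁⇒S₀[+m] x∈S₁))

S₁-closed[+m∸1] : ∀ {m S₀ S₁} → Hyp (suc m) S₀ S₁ → ClosedUnder+ S₁ (m ∸ 1)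
S₁-closed[+m∸1] {zero}  {S₁ = S₁} _ x x∈S₁ = subst S₁ (sym (+-identityʳ x)) x∈S₁
S₁-closed[+m∸1] {suc p} {S₁ = S₁} H x x∈S₁ = subst S₁ (cong (x +_) (sum-ones p))
  (Hyp.shift∈S₁ H 0 (Hyp.zero∈S₀ H) (x ∷ ones p) (x∈S₁ ∷ All-ones H p))

m*[m∸1]+m≡m*m : ∀ m → m * (m ∸ 1) + m ≡ m * m
m*[m∸1]+m≡m*m zero    = refl
m*[m∸1]+m≡m*m (suc p) = trans (+-comm (suc p * p) (suc p)) (sym (*-suc (suc p) p))

common-element : ∀ {m} → Even m →
  ∃ λ A → ∀ (S₀ S₁ : ℕ → Set) → Hyp (suc m) S₀ S₁ → S₀ A × S₁ A
common-element {m} (k , refl) = 1 + m * m , λ S₀ S₁ H →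
    subst S₀ (cong suc (m*[m∸1]+m≡m*m m))
      (S₁⇒S₀[+m] H (closedUnder+-* (S₁-closed[+m∸1] H) m 1 (Hyp.one∈S₁ H)))
  , subst S₁ (cong suc (2k-steps k))
      (closedUnder+-* (S₁-closed[+m+m] H) k 1 (Hyp.one∈S₁ H))
  where
  2k-steps : ∀ k → k * (2 * k + 2 * k) ≡ 2 * k * (2 * k)
  2k-steps = solve-∀

-- Write t = r + k q with r < q; then 2q² + t = (k + 2(q − r)) q + r (2q + 1).
combination-from-division : ∀ {q t} r k s → suc (r + s) ≡ q → r + k * q ≡ t →
  ∃₂ λ i j → i * q + j * (2 * q + 1) ≡ 2 * q * q + t
combination-from-division r k s refl refl = k + 2 * suc s , r , identity r k s
  where
  identity : ∀ r k s → let q = suc (r + s) in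
    (k + 2 * suc s) * q + r * (2 * q + 1) ≡ 2 * q * q + (r + k * q)
  identity = solve-∀

combination[q,2q+1]≡2q²+t : ∀ q t → ∃₂ λ i j → i * q + j * (2 * q + 1) ≡ 2 * q * q + t
combination[q,2q+1]≡2q²+t zero    t = 0 , t , *-identityʳ t
combination[q,2q+1]≡2q²+t q@(suc _) t with m≤n⇒∃[o]m+o≡n (m%n<n t q)
... | s , r+1+s≡q = combination-from-division (t % q) (t / q) s r+1+s≡q (sym (m≡m%n+[m/n]*n t q))

odd-beyond-4q²∈S₁ : ∀ {q S₀ S₁} → Hyp (suc (suc (2 * q))) S₀ S₁ →
  ∀ t → S₁ (suc (2 * (2 * q * q + t)))
odd-beyond-4q²∈S₁ {q} {S₁ = S₁} H t with combination[q,2q+1]≡2q²+t q t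
... | i , j , combination =
  subst S₁ (trans (doubled i j q) (cong (λ z → suc (2 * z)) combination))
    (closedUnder+-* (S₁-closed[+m∸1] H) i _
      (closedUnder+-* (S₁-closed[+m+m] H) j 1 (Hyp.one∈S₁ H)))
  where
  doubled : ∀ i j q → 1 + j * (suc (2 * q) + suc (2 * q)) + i * (2 * q)
                      ≡ suc (2 * (i * q + j * (2 * q + 1)))
  doubled = solve-∀

2*m≤1+2*n⇒m≤n : ∀ {m n} → 2 * m ≤ suc (2 * n) → m ≤ n
2*m≤1+2*n⇒m≤n {m} {n} 2m≤1+2n =
  s≤s⁻¹ (*-cancelˡ-< 2 m (suc n) (≤-trans (s≤s 2m≤1+2n) (≤-reflexive (sym (*-suc 2 n)))))

even-beyond : ∀ {P : ℕ → Set} c → (∀ t → P (2 * (c + t))) → ∀ m → 2 * c ≤ m → Even m → P m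
even-beyond c P[2c+2t] _ 2c≤2k (k , refl) with m≤n⇒∃[o]m+o≡n {c} {k} (*-cancelˡ-≤ 2 2c≤2k)
... | t , refl = P[2c+2t] t

odd-beyond : ∀ {P : ℕ → Set} c → (∀ t → P (suc (2 * (c + t)))) → ∀ m → 2 * c ≤ m → Odd m → P m
odd-beyond c P[1+2c+2t] _ 2c≤1+2k (k , refl) with m≤n⇒∃[o]m+o≡n {c} {k} (2*m≤1+2*n⇒m≤n 2c≤1+2k)
... | t , refl = P[1+2c+2t] t

even-suc⇒odd : ∀ {m} → Even (suc m) → Odd m
even-suc⇒odd (suc k , 1+m≡2+2k) = k , trans (suc-injective 1+m≡2+2k) (+-suc k (k + 0))

large-parity-classes : ∀ {m} → Odd m → ∃ λ d → ∀ (S₀ S₁ : ℕ → Set) → Hyp (suc m) S₀ S₁ →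
  (∀ x → d ≤ x → Even x → S₀ x) × (∀ x → d ≤ x → Odd x → S₁ x)
large-parity-classes (q , refl) = 2 * c , λ S₀ S₁ H →
    even-beyond c (λ t → subst S₀ (to-even q t) (S₁⇒S₀[+m] H (odd-beyond-4q²∈S₁ {q} H t)))
  , odd-beyond c (λ t → subst S₁ (cong (λ z → suc (2 * z)) (sym (+-assoc (2 * q * q) (suc q) t)))
                            (odd-beyond-4q²∈S₁ {q} H (suc q + t)))
  where
  c : ℕ
  c = 2 * q * q + suc q
  to-even : ∀ q t → suc (2 * (2 * q * q + t)) + suc (2 * q) ≡ 2 * (2 * q * q + suc q + t)
  to-even = solve-∀

lemma4p8 : (n : ℕ) → 1 ≤ n →
    (Odd n → ∃ λ A → ∀ (S₀ S₁ : ℕ → Set) → Hyp n S₀ S₁ → S₀ A × S₁ A)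
    × (Even n → ∃ λ d → ∀ (S₀ S₁ : ℕ → Set) → Hyp n S₀ S₁ →
         (∀ m → d ≤ m → Even m → S₀ m) × (∀ m → d ≤ m → Odd m → S₁ m))
lemma4p8 zero    ()
lemma4p8 (suc m) _ =
    (λ n-odd → common-element (map₂ suc-injective n-odd))
  , (λ n-even → large-parity-classes (even-suc⇒odd n-even))
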